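{- Let $G$ be a connected graph and $H$ a graph with $k\ge1$ connected components $H_1,\dots,H_k$, each of order $m_i\ge2$. Let $Z$ be a zero forcing set of $G\circ H$. For $a\in V(G)$ put $H(a)=\{(a,v):v\in V(H)\}$, $H_i(a)=\{(a,v):v\in V(H_i)\}$, $Z_i(a)=Z\cap H_i(a)$ and $Z(a)=\bigcup_{1\le i\le k}Z_i(a)$. Then $Z(a)$ is a zero forcing set of the subgraph of $G\circ H$ induced by $H(a)$.
   Context: Graphs are finite, simple, undirected, with at least two vertices. Zero forcing: given a set $S$ of initially black vertices (others white), the color-change rule turns a white vertex black if it is the only white neighbor of some black vertex; $S$ is a zero forcing set if eventually all vertices become black. The lexicographic product $G\circ H$ has vertex set $V(G)\times V(H)$, with $(a,v)$ adjacent to $(b,w)$ iff $ab\in E(G)$, or $a=b$ and $vw\in E(H)$. -}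

module Defs where

open import Level using (0ℓ)
open import Data.Nat using (ℕ; _≥_)
open import Data.Fin using (Fin)
open import Data.Product using (Σ; _×_; _,_; proj₁; proj₂; ∃)
open import Data.Sum using (_⊎_; inj₁; inj₂)
open import Data.Empty using (⊥)
open import Relation.Nullary using (¬_)
open import Relation.Binary.PropositionalEquality using (_≡_; _≢_; refl)
open import Relation.Binary.Construct.Closure.ReflexiveTransitive using (Star)

record Graph (V : Set) : Set₁ where
  field
    Adj   : V → V → Set
    symm  : ∀ {u v} → Adj u v → Adj v u
    irref : ∀ {v} → ¬ Adj v v
open Graph public

FinGraph : ℕ → Set₁
FinGraph n = Graph (Fin n)

Reachable : ∀ {V} → Graph V → V → V → Set
Reachable G = Star (Adj G)

Connected : ∀ {V} → Graph V → Set
Connected {V} G = ∀ (u v : V) → Reachable G u v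

AllComponentsNontrivial : ∀ {V} → Graph V → Set
AllComponentsNontrivial {V} G = ∀ (v : V) → Σ V (λ w → w ≢ v × Reachable G v w)

data Black {V : Set} (G : Graph V) (S : V → Set) : V → Set where
  init  : ∀ {v} → S v → Black G S v
  force : ∀ {u v} → Black G S u → Adj G u v
        → (∀ w → Adj G u w → w ≢ v → Black G S w)
        → Black G S v

IsZeroForcingSet : ∀ {V} → Graph V → (V → Set) → Set
IsZeroForcingSet {V} G S = ∀ (v : V) → Black G S v

lexAdj : ∀ {A B} → Graph A → Graph B → A × B → A × B → Set
lexAdj G H (a , v) (b , w) = Adj G a b ⊎ (a ≡ b × Adj H v w)

lex : ∀ {A B} → Graph A → Graph B → Graph (A × B)
lex G H = record
  { Adj   = lexAdj G H
  ; symm  = λ { (inj₁ p) → inj₁ (symm G p)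
              ; (inj₂ (refl , q)) → inj₂ (refl , symm H q) }
  ; irref = λ { (inj₁ p) → irref G p ; (inj₂ (_ , q)) → irref H q }
  }

induced : ∀ {V} → Graph V → (P : V → Set) → Graph (Σ V P)
induced G P = record
  { Adj   = λ x y → Adj G (proj₁ x) (proj₁ y)
  ; symm  = symm G
  ; irref = irref G
  }

Fiber : ∀ {A B : Set} → A → A × B → Set
Fiber a x = proj₁ x ≡ a

restrict : ∀ {A B : Set} (a : A) → (A × B → Set) → Σ (A × B) (Fiber a) → Set
restrict a Z x = Z (proj₁ x)

-- A force into the fibre H(a) either comes from inside H(a), where it is still a
-- force of the induced subgraph, or from some (b , y) with b adjacent to a.  In the
-- latter case (b , y) is adjacent to all of H(a), so every vertex of H(a) other than
-- the forced one (a , v) is already black; any H-neighbour (a , v') of (a , v) then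
-- forces (a , v) inside H(a).
module Submission where

open import Defs
open import Data.Nat using (ℕ; _≥_)
open import Data.Fin using (Fin)
open import Data.Product using (Σ; ∃; _×_; _,_; proj₂)
open import Data.Sum using (inj₁; inj₂)
open import Data.Empty using (⊥-elim)
open import Relation.Binary.PropositionalEquality using (_≢_; refl; cong)
open import Relation.Binary.Construct.Closure.ReflexiveTransitive using (ε; _◅_)

NoIsolatedVertices : ∀ {V} → Graph V → Set
NoIsolatedVertices {V} G = ∀ (v : V) → ∃ (Adj G v)

module _ {V : Set} (G : Graph V) where

  adj⇒≢ : ∀ {u v} → Adj G u v → u ≢ v
  adj⇒≢ uv refl = irref G uv

  nontrivialComponents⇒noIsolatedVertices :
    AllComponentsNontrivial G → NoIsolatedVertices G
  nontrivialComponents⇒noIsolatedVertices nt v with nt v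
  ... | _ , w≢v , ε                = ⊥-elim (w≢v refl)
  ... | _ , _ , (_◅_ {j = u} vu _) = u , vu

module _ {A B : Set} (G : Graph A) (H : Graph B) (Z : A × B → Set) (a : A) where

  private
    Fibre : Graph (Σ (A × B) (Fiber a))
    Fibre = induced (lex G H) (Fiber a)

  fibreVertex : B → Σ (A × B) (Fiber a)
  fibreVertex v = (a , v) , refl

  fibreVertex-≢⁻ : ∀ {v w} → fibreVertex w ≢ fibreVertex v → w ≢ v
  fibreVertex-≢⁻ w≢v w≡v = w≢v (cong fibreVertex w≡v)

  pair-≢ : ∀ {v w : B} → w ≢ v → (a , w) ≢ (a , v)
  pair-≢ w≢v eq = w≢v (cong proj₂ eq)

  black⇒blackInFibre : NoIsolatedVertices H →
    ∀ {v} → Black (lex G H) Z (a , v) → Black Fibre (restrict a Z) (fibreVertex v)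
  black⇒blackInFibre nbr (init z) = init z
  black⇒blackInFibre nbr {v} (force bu (inj₂ (refl , yv)) others) =
    force (black⇒blackInFibre nbr bu) (inj₂ (refl , yv))
      λ { ((_ , w) , refl) yw w≢v →
          black⇒blackInFibre nbr (others (a , w) yw (pair-≢ (fibreVertex-≢⁻ w≢v))) }
  black⇒blackInFibre nbr {v} (force {u = b , y} _ (inj₁ ba) others)
    with nbr v
  ... | v′ , vv′ =
    force (blackUnlessV (adj⇒≢ H (symm H vv′))) (inj₂ (refl , symm H vv′))
      λ { ((_ , w) , refl) _ w≢v → blackUnlessV (fibreVertex-≢⁻ w≢v) }
    where
    blackUnlessV : ∀ {w} → w ≢ v → Black Fibre (restrict a Z) (fibreVertex w)
    blackUnlessV {w} w≢v =
      black⇒blackInFibre nbr (others (a , w) (inj₁ ba) (pair-≢ w≢v))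

mainTheorem15 : (n m : ℕ) → n ≥ 2 → m ≥ 2
    → (G : FinGraph n) (H : FinGraph m)
    → Connected G
    → AllComponentsNontrivial H
    → (Z : Fin n × Fin m → Set)
    → IsZeroForcingSet (lex G H) Z
    → (a : Fin n)
    → IsZeroForcingSet (induced (lex G H) (Fiber a)) (restrict a Z)
mainTheorem15 n m _ _ G H _ ntH Z zf a ((_ , v) , refl) =
  black⇒blackInFibre G H Z a (nontrivialComponents⇒noIsolatedVertices H ntH) (zf (a , v))
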